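{- If $q > 3$ is a prime, then $\chi_a(\mathcal{U}(\mathbb{Z}_{3q})) = \frac{3q+1}{2}$.
   Context: For a finite ring $R$ with unity and unit group $R^*$, the unitary addition Cayley graph $\mathcal{U}(R)$ is the simple graph with vertex set $R$ in which distinct vertices $x,y$ are adjacent if and only if $x+y \in R^*$; $\mathbb{Z}_n$ is the ring of integers modulo $n$. The achromatic number $\chi_a(G)$ of a graph $G$ is the maximum number of colors in a proper vertex coloring of $G$ such that for every pair of distinct color classes there is at least one edge of $G$ joining a vertex of one class to a vertex of the other. -}

module Defs where

open import Data.Nat using (ℕ; suc; _+_; _*_; _≤_; _%_; NonZero)
open import Data.Fin using (Fin; toℕ)
open import Data.Product using (Σ; ∃; _×_; _,_)
open import Relation.Nullary using (¬_)
open import Relation.Binary.PropositionalEquality using (_≡_; _≢_)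

record Graph (n : ℕ) : Set₁ where
  field
    Adj : Fin n → Fin n → Set

open Graph public

addℤ : (n : ℕ) → .{{_ : NonZero n}} → Fin n → Fin n → ℕ
addℤ n x y = (toℕ x + toℕ y) % n

IsUnitℤ : (n : ℕ) → .{{_ : NonZero n}} → ℕ → Set
IsUnitℤ n r = Σ (Fin n) λ s → (r * toℕ s) % n ≡ 1 % n

unitaryAdditionCayley : (n : ℕ) → .{{_ : NonZero n}} → Graph n
unitaryAdditionCayley n = record { Adj = λ x y → x ≢ y × IsUnitℤ n (addℤ n x y) }

record CompleteColoring {n : ℕ} (G : Graph n) (k : ℕ) : Set where
  field
    color    : Fin n → Fin k
    proper   : ∀ u v → Adj G u v → color u ≢ color v
    surj     : ∀ i → ∃ λ u → color u ≡ i
    complete : ∀ i j → i ≢ j →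
               ∃ λ u → ∃ λ v → Adj G u v × color u ≡ i × color v ≡ j

AchromaticNumber : {n : ℕ} → Graph n → ℕ → Set
AchromaticNumber G m = CompleteColoring G m × (∀ k → CompleteColoring G k → k ≤ m)

{-# OPTIONS --safe #-}
module Submission where

-- Write q = 2m + 1 and give each vertex u of U(ℤ₃q) the coordinates (a, r) of its balanced
-- residues modulo 3 and q; by the Chinese remainder theorem this is a bijection, and u + v is a
-- unit iff neither coordinate of v is the negative of that of u.
--
-- Lower bound: the classes {(0, r), (1, −r)} for 0 < r ≤ m, {(0, r), (2, −r)} for −m ≤ r < 0,
-- {(0, 0)}, and m + 1 classes pairing the remaining vertices with a = 1 and a = 2 form a complete
-- colouring with q + m + 1 = (3q + 1)/2 colours.
--
-- Upper bound: V₀ = {a = 0} is independent, so at most one colour class lies inside V₀.  If {w}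
-- is a singleton class with w ∉ V₀, the vertex v = (0, −r_w) is not adjacent to w, so the edge
-- joining the class of v to {w} starts at another vertex of that class; this forces the class
-- of v inside V₀, and distinct such singletons give distinct v.  So every colour can be paid two
-- tokens by distinct vertices (a singleton class borrowing its v), except the class inside V₀,
-- which takes two extra tokens: 2k ≤ 3q + 2.

open import Defs
open import Algebra.Properties.CommutativeSemigroup using (x∙yz≈y∙xz)
open import Data.Fin as Fin using (Fin; toℕ; _↑ˡ_; _↑ʳ_; splitAt; join; opposite; punchOut; combine)
open import Data.Fin.Patterns using (0F; 1F)
open import Data.Fin.Properties
  using ( toℕ-fromℕ<; toℕ-injective; toℕ<n; toℕ-↑ˡ; toℕ-↑ʳ; splitAt-↑ˡ; splitAt-↑ʳ; join-splitAt
        ; opposite-prop; opposite-involutive; punchOut-injective; injective⇒≤; combine-injective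
        ; any?; all?; +↔⊎; *↔× )
open import Data.Nat using (ℕ; zero; suc; _+_; _*_; _∸_; _≤_; _<_; _%_; _/_; ∣_-_∣; NonZero; s≤s; s≤s⁻¹)
open import Data.Nat.Coprimality as Coprimality
  using (Coprime; coprime-Bézout; coprime-divisor; prime⇒coprime)
open import Data.Nat.Divisibility
  using ( _∣_; divides; _∣0; ∣-refl; ∣-reflexive; ∣-trans; ∣1⇒≡1; ∣m⇒∣m*n; n∣m*n; ∣m∣n⇒∣m+n
        ; %-presˡ-∣; ∣n∣m%n⇒∣m; m%n≡0⇒n∣m; n∣m⇒m%n≡0 )
open import Data.Nat.DivMod
  using (_mod_; m≡m%n+[m/n]*n; m<n⇒m%n≡m; %-distribˡ-+; %-distribˡ-*; m%n%n≡m%n; [m+kn]%n≡m%n; m*n/n≡m)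
open import Data.Nat.GCD using (module Bézout)
open import Data.Nat.Primality using (Prime; prime?; prime⇒irreducible; prime⇒nonZero; ¬prime[1])
open import Data.Nat.Properties
  using ( +-comm; +-suc; *-comm; *-assoc; +-commutativeSemigroup; m+[n∸m]≡n; suc-pred; ≤-<-trans; <⇒≤; <⇒≢
        ; ⊔-lub; 1+n≰n; *-cancelʳ-<; m*n≢0; ∣m-n∣≡0⇒m≡n; ∣m-n∣≤m⊔n; ∣m+n-m+o∣≡∣n-o∣; *-distribʳ-∣-∣ )
open import Data.Nat.Tactic.RingSolver using (solve-∀)
open import Data.Product using (∃; ∃₂; _×_; _,_; proj₁; proj₂; uncurry)
open import Data.Sum using (_⊎_; inj₁; inj₂; [_,_]′)
open import Data.Sum.Function.Propositional using (_⊎-↔_)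
open import Function using (_∘_; _↔_; Inverse; _⇔_; mk⇔; mk↔ₛ′; Equivalence)
open import Function.Construct.Composition using (_⇔-∘_; _↔-∘_)
open import Function.Properties.Inverse using (↔-sym; ↔-refl)
open import Relation.Binary using (DecidableEquality)
open import Relation.Binary.PropositionalEquality
open import Relation.Nullary using (¬_; Dec; yes; no; contradiction)
open import Relation.Nullary.Decidable using (map′; from-yes; decidable-stable; _×-dec_; _→-dec_; ¬?)

injective⇒surjective : ∀ {n} {f : Fin n → Fin n} → (∀ {x y} → f x ≡ f y → x ≡ y) →
                       ∀ y → ∃ λ x → f x ≡ y
injective⇒surjective {suc n} {f} f-injective y with any? (λ x → f x Fin.≟ y)
... | yes hit = hit
... | no  miss = contradiction (injective⇒≤ punchOut∘f-injective) 1+n≰n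
  where
  y∉f : ∀ x → y ≢ f x
  y∉f x y≡fx = miss (x , sym y≡fx)
  punchOut∘f : Fin (suc n) → Fin n
  punchOut∘f x = punchOut (y∉f x)
  punchOut∘f-injective : ∀ {x x′} → punchOut∘f x ≡ punchOut∘f x′ → x ≡ x′
  punchOut∘f-injective {x} {x′} = f-injective ∘ punchOut-injective (y∉f x) (y∉f x′)

surjection⇒≤ : ∀ {a b} {A B : Set} → Fin a ↔ A → Fin b ↔ B →
               (f : A → B) → (∀ y → ∃ λ x → f x ≡ y) → b ≤ a
surjection⇒≤ {a} {b} {A} {B} A↔ B↔ f f-surjective = injective⇒≤ section-injective
  where
  open Inverse
  preimage : B → A
  preimage y = proj₁ (f-surjective y)
  section : Fin b → Fin a
  section j = from A↔ (preimage (to B↔ j))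
  section-injective : ∀ {i j} → section i ≡ section j → i ≡ j
  section-injective {i} {j} eq = begin
    i                                ≡⟨ strictlyInverseʳ B↔ i ⟨
    from B↔ (to B↔ i)                ≡⟨ cong (from B↔) (proj₂ (f-surjective (to B↔ i))) ⟨
    from B↔ (f (preimage (to B↔ i))) ≡⟨ cong (from B↔ ∘ f) preimages-equal ⟩
    from B↔ (f (preimage (to B↔ j))) ≡⟨ cong (from B↔) (proj₂ (f-surjective (to B↔ j))) ⟩
    from B↔ (to B↔ j)                ≡⟨ strictlyInverseʳ B↔ j ⟩
    j                                ∎
    where
    open ≡-Reasoning
    preimages-equal : preimage (to B↔ i) ≡ preimage (to B↔ j)
    preimages-equal = trans (sym (strictlyInverseˡ A↔ _)) (trans (cong (to A↔) eq) (strictlyInverseˡ A↔ _))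

m%d≡n%d⇒d∣∣m-n∣ : ∀ m n d .{{_ : NonZero d}} → m % d ≡ n % d → d ∣ ∣ m - n ∣
m%d≡n%d⇒d∣∣m-n∣ m n d eq = divides ∣ m / d - n / d ∣ (begin
  ∣ m - n ∣                                 ≡⟨ cong₂ ∣_-_∣ (m≡m%n+[m/n]*n m d) (m≡m%n+[m/n]*n n d) ⟩
  ∣ m % d + m / d * d - n % d + n / d * d ∣ ≡⟨ cong (λ r → ∣ m % d + m / d * d - r + n / d * d ∣) eq ⟨
  ∣ m % d + m / d * d - m % d + n / d * d ∣ ≡⟨ ∣m+n-m+o∣≡∣n-o∣ (m % d) (m / d * d) (n / d * d) ⟩
  ∣ m / d * d - n / d * d ∣                 ≡⟨ *-distribʳ-∣-∣ d (m / d) (n / d) ⟨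
  ∣ m / d - n / d ∣ * d                     ∎)
  where open ≡-Reasoning

d∣∣m-n∣⇒m≡n : ∀ {m n d} → d ∣ ∣ m - n ∣ → m < d → n < d → m ≡ n
d∣∣m-n∣⇒m≡n {m} {n} {d@(suc _)} d∣∣m-n∣ m<d n<d = ∣m-n∣≡0⇒m≡n (begin
  ∣ m - n ∣     ≡⟨ m<n⇒m%n≡m (≤-<-trans (∣m-n∣≤m⊔n m n) (⊔-lub m<d n<d)) ⟨
  ∣ m - n ∣ % d ≡⟨ n∣m⇒m%n≡0 _ d d∣∣m-n∣ ⟩
  0             ∎)
  where open ≡-Reasoning

d∣m+n∧d∣m+o⇒n≡o : ∀ {d m n o} → d ∣ m + n → d ∣ m + o → n < d → o < d → n ≡ o
d∣m+n∧d∣m+o⇒n≡o {d@(suc _)} {m} {n} {o} d∣m+n d∣m+o = d∣∣m-n∣⇒m≡n d∣∣n-o∣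
  where
  d∣∣n-o∣ : d ∣ ∣ n - o ∣
  d∣∣n-o∣ = subst (d ∣_) (∣m+n-m+o∣≡∣n-o∣ m n o)
    (m%d≡n%d⇒d∣∣m-n∣ (m + n) (m + o) d (trans (n∣m⇒m%n≡0 _ d d∣m+n) (sym (n∣m⇒m%n≡0 _ d d∣m+o))))

∣m+n⇔∣m%d+n%d : ∀ m n d .{{_ : NonZero d}} → d ∣ m + n ⇔ d ∣ m % d + n % d
∣m+n⇔∣m%d+n%d m n d = mk⇔
  (λ d∣m+n → m%n≡0⇒n∣m _ d (trans (sym (%-distribˡ-+ m n d)) (n∣m⇒m%n≡0 _ d d∣m+n)))
  (λ d∣m%d+n%d → m%n≡0⇒n∣m _ d (trans (%-distribˡ-+ m n d) (n∣m⇒m%n≡0 _ d d∣m%d+n%d)))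

coprime⇒*∣ : ∀ {m n o} → Coprime m n → m ∣ o → n ∣ o → m * n ∣ o
coprime⇒*∣ {m} {n} {o} m⊥n (divides k o≡k*m) n∣o with coprime-divisor (Coprimality.sym m⊥n) n∣m*k
  where
  n∣m*k : n ∣ m * k
  n∣m*k = subst (n ∣_) (trans o≡k*m (*-comm k m)) n∣o
... | divides j k≡j*n = divides j (begin
  o           ≡⟨ o≡k*m ⟩
  k * m       ≡⟨ cong (_* m) k≡j*n ⟩
  j * n * m   ≡⟨ *-assoc j n m ⟩
  j * (n * m) ≡⟨ cong (j *_) (*-comm n m) ⟩
  j * (m * n) ∎)
  where open ≡-Reasoning

module ChineseRemainder {a b} .{{_ : NonZero a}} .{{_ : NonZero b}} (a⊥b : Coprime a b) where

  residues : Fin (a * b) → Fin a × Fin b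
  residues x = toℕ x mod a , toℕ x mod b

  residues-injective : ∀ {x y} → residues x ≡ residues y → x ≡ y
  residues-injective {x} {y} eq = toℕ-injective (d∣∣m-n∣⇒m≡n ab∣∣x-y∣ (toℕ<n x) (toℕ<n y))
    where
    congruent : ∀ d .{{_ : NonZero d}} → toℕ (toℕ x mod d) ≡ toℕ (toℕ y mod d) → toℕ x % d ≡ toℕ y % d
    congruent d eq′ = trans (sym (toℕ-fromℕ< _)) (trans eq′ (toℕ-fromℕ< _))
    ab∣∣x-y∣ : a * b ∣ ∣ toℕ x - toℕ y ∣
    ab∣∣x-y∣ = coprime⇒*∣ a⊥b
      (m%d≡n%d⇒d∣∣m-n∣ _ _ a (congruent a (cong (toℕ ∘ proj₁) eq)))
      (m%d≡n%d⇒d∣∣m-n∣ _ _ b (congruent b (cong (toℕ ∘ proj₂) eq)))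

  residues-surjective : ∀ r → ∃ λ x → residues x ≡ r
  residues-surjective (i , j) =
    let (x , eq) = injective⇒surjective combine∘residues-injective (combine i j)
    in x , uncurry (cong₂ _,_) (combine-injective _ _ i j eq)
    where
    combine∘residues : Fin (a * b) → Fin (a * b)
    combine∘residues x = combine (toℕ x mod a) (toℕ x mod b)
    combine∘residues-injective : ∀ {x y} → combine∘residues x ≡ combine∘residues y → x ≡ y
    combine∘residues-injective eq = residues-injective (uncurry (cong₂ _,_) (combine-injective _ _ _ _ eq))

-- Units of ℤₙ

m*[n%d]%d≡m*n%d : ∀ m n d .{{_ : NonZero d}} → m * (n % d) % d ≡ m * n % d
m*[n%d]%d≡m*n%d m n d = begin
  m * (n % d) % d         ≡⟨ %-distribˡ-* m (n % d) d ⟩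
  m % d * (n % d % d) % d ≡⟨ cong (λ r → m % d * r % d) (m%n%n≡m%n n d) ⟩
  m % d * (n % d) % d     ≡⟨ %-distribˡ-* m n d ⟨
  m * n % d               ∎
  where open ≡-Reasoning

inverse⇒isUnit : ∀ {x n} .{{_ : NonZero n}} s → x * s % n ≡ 1 % n → IsUnitℤ n x
inverse⇒isUnit {x} {n} s xs≡1 =
  s mod n , trans (cong (λ r → x * r % n) (toℕ-fromℕ< _)) (trans (m*[n%d]%d≡m*n%d x s n) xs≡1)

isUnit⇒coprime : ∀ {x n} .{{_ : NonZero n}} → IsUnitℤ n x → Coprime x n
isUnit⇒coprime {x} {n} (s , xs≡1) {d} (d∣x , d∣n) = ∣1⇒≡1 (∣n∣m%n⇒∣m d∣n d∣1%n)
  where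
  d∣1%n : d ∣ 1 % n
  d∣1%n = subst (d ∣_) xs≡1 (%-presˡ-∣ (∣m⇒∣m*n (toℕ s) d∣x) d∣n)

coprime⇒isUnit : ∀ {x n} .{{_ : NonZero n}} → Coprime x n → IsUnitℤ n x
coprime⇒isUnit {x} {n} x⊥n with coprime-Bézout x⊥n
... | Bézout.+- s t 1+tn≡sx = inverse⇒isUnit {x} s (begin
  x * s % n       ≡⟨ cong (_% n) (*-comm x s) ⟩
  s * x % n       ≡⟨ cong (_% n) 1+tn≡sx ⟨
  (1 + t * n) % n ≡⟨ [m+kn]%n≡m%n 1 t n ⟩
  1 % n           ∎)
  where open ≡-Reasoning
-- Here s inverts −x, so s (n − 1) inverts x.
... | Bézout.-+ s t 1+sx≡tn = inverse⇒isUnit {x} (s * (n ∸ 1)) (begin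
  x * (s * (n ∸ 1)) % n                 ≡⟨ [m+kn]%n≡m%n _ t n ⟨
  (x * (s * (n ∸ 1)) + t * n) % n       ≡⟨ cong (λ r → (x * (s * (n ∸ 1)) + r) % n) 1+sx≡tn ⟨
  (x * (s * (n ∸ 1)) + (1 + s * x)) % n ≡⟨ cong (_% n) (-1·-1≡1 x s (n ∸ 1)) ⟩
  (1 + x * s * suc (n ∸ 1)) % n         ≡⟨ cong (λ r → (1 + x * s * r) % n) (suc-pred n) ⟩
  (1 + x * s * n) % n                   ≡⟨ [m+kn]%n≡m%n 1 (x * s) n ⟩
  1 % n                                 ∎)
  where
  open ≡-Reasoning
  -1·-1≡1 : ∀ x s k → x * (s * k) + (1 + s * x) ≡ 1 + x * s * suc k
  -1·-1≡1 = solve-∀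

coprime-* : ∀ {x m n} → Coprime x m → Coprime x n → Coprime x (m * n)
coprime-* {x} {m} x⊥m x⊥n {d} (d∣x , d∣mn) = x⊥n (d∣x , coprime-divisor d⊥m d∣mn)
  where
  d⊥m : Coprime d m
  d⊥m (e∣d , e∣m) = x⊥m (∣-trans e∣d d∣x , e∣m)

¬∣⇒coprime : ∀ {p x} → Prime p → ¬ p ∣ x → Coprime x p
¬∣⇒coprime p-prime p∤x (d∣x , d∣p) with prime⇒irreducible p-prime d∣p
... | inj₁ d≡1  = d≡1
... | inj₂ refl = contradiction d∣x p∤x

isUnit[%]⇔¬∣ : ∀ {p p′} .{{_ : NonZero (p * p′)}} → Prime p → Prime p′ → ∀ s →
               IsUnitℤ (p * p′) (s % (p * p′)) ⇔ (¬ p ∣ s × ¬ p′ ∣ s)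
isUnit[%]⇔¬∣ {p} {p′} p-prime p′-prime s = mk⇔
  (λ unit → ¬∣unit p-prime p∣n unit , ¬∣unit p′-prime p′∣n unit)
  (λ (p∤s , p′∤s) → coprime⇒isUnit (coprime-*
    (¬∣⇒coprime p-prime (p∤s ∘ ∣n∣m%n⇒∣m p∣n))
    (¬∣⇒coprime p′-prime (p′∤s ∘ ∣n∣m%n⇒∣m p′∣n))))
  where
  p∣n : p ∣ p * p′
  p∣n = ∣m⇒∣m*n p′ ∣-refl
  p′∣n : p′ ∣ p * p′
  p′∣n = n∣m*n p
  ¬∣unit : ∀ {d} → Prime d → d ∣ p * p′ → IsUnitℤ (p * p′) (s % (p * p′)) → ¬ d ∣ s
  ¬∣unit d-prime d∣n unit d∣s =
    ¬prime[1] (subst Prime (isUnit⇒coprime unit (%-presˡ-∣ d∣s d∣n , d∣n)) d-prime)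

completeColoring-via : ∀ {n k} {G : Graph n} {C : Set} → C ↔ Fin k → (colour : Fin n → C) →
  (∀ u v → Adj G u v → colour u ≢ colour v) →
  (∀ γ → ∃ λ u → colour u ≡ γ) →
  (∀ γ δ → γ ≢ δ → ∃₂ λ u v → Adj G u v × colour u ≡ γ × colour v ≡ δ) →
  CompleteColoring G k
completeColoring-via code colour proper′ surj′ complete′ = record
  { color    = to ∘ colour
  ; proper   = λ u v adj → proper′ u v adj ∘ to-injective
  ; surj     = λ i → let (u , cu≡) = surj′ (from i) in u , trans (cong to cu≡) (strictlyInverseˡ i)
  ; complete = λ i j i≢j →
      let (u , v , adj , cu≡ , cv≡) = complete′ (from i) (from j) (i≢j ∘ from-injective)
      in u , v , adj , trans (cong to cu≡) (strictlyInverseˡ i) , trans (cong to cv≡) (strictlyInverseˡ j)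
  }
  where
  open Inverse code
  to-injective : ∀ {γ δ} → to γ ≡ to δ → γ ≡ δ
  to-injective {γ} {δ} eq = trans (sym (strictlyInverseʳ γ)) (trans (cong from eq) (strictlyInverseʳ δ))
  from-injective : ∀ {i j} → from i ≡ from j → i ≡ j
  from-injective {i} {j} eq = trans (sym (strictlyInverseˡ i)) (trans (cong to eq) (strictlyInverseˡ j))

-- The balanced residues modulo 2m + 1: +[ s ] stands for s ≤ m and -[1+ s ] for −(s + 1).
data Balanced (m : ℕ) : Set where
  +[_]   : Fin (suc m) → Balanced m
  -[1+_] : Fin m → Balanced m

module _ {m : ℕ} where

  infix 8 -_
  infix 4 _≟_

  -_ : Balanced m → Balanced m
  - +[ 0F ]        = +[ 0F ]
  - +[ Fin.suc s ] = -[1+ s ]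
  - -[1+ s ]       = +[ Fin.suc s ]

  neg-involutive : ∀ x → - - x ≡ x
  neg-involutive +[ 0F ]        = refl
  neg-involutive +[ Fin.suc s ] = refl
  neg-involutive -[1+ s ]       = refl

  neg-injective : ∀ {x y} → - x ≡ - y → x ≡ y
  neg-injective {x} {y} -x≡-y = begin
    x     ≡⟨ neg-involutive x ⟨
    - - x ≡⟨ cong -_ -x≡-y ⟩
    - - y ≡⟨ neg-involutive y ⟩
    y     ∎
    where open ≡-Reasoning

  neg-sym : ∀ {x y} → y ≡ - x → x ≡ - y
  neg-sym {x} refl = sym (neg-involutive x)

  +[s]≡-+[t]⇒s≡t≡0 : ∀ {s t} → +[ s ] ≡ - +[ t ] → s ≡ 0F × t ≡ 0F
  +[s]≡-+[t]⇒s≡t≡0 {t = 0F} refl = refl , refl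

  ⟦_⟧ : Balanced m → Fin (suc m + m)
  ⟦ +[ s ] ⟧   = s ↑ˡ m
  ⟦ -[1+ s ] ⟧ = suc m ↑ʳ opposite s

  fromFin : Fin (suc m + m) → Balanced m
  fromFin i = [ +[_] , -[1+_] ∘ opposite ]′ (splitAt (suc m) i)

  fromFin-⟦⟧ : ∀ x → fromFin ⟦ x ⟧ ≡ x
  fromFin-⟦⟧ +[ s ]   rewrite splitAt-↑ˡ (suc m) s m = refl
  fromFin-⟦⟧ -[1+ s ] rewrite splitAt-↑ʳ (suc m) m (opposite s) = cong -[1+_] (opposite-involutive s)

  ⟦⟧-fromFin : ∀ i → ⟦ fromFin i ⟧ ≡ i
  ⟦⟧-fromFin i = trans (⟦⟧∘[+,-]≡join (splitAt (suc m) i)) (join-splitAt (suc m) m i)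
    where
    ⟦⟧∘[+,-]≡join : ∀ y → ⟦ [ +[_] , -[1+_] ∘ opposite ]′ y ⟧ ≡ join (suc m) m y
    ⟦⟧∘[+,-]≡join (inj₁ s) = refl
    ⟦⟧∘[+,-]≡join (inj₂ t) = cong (suc m ↑ʳ_) (opposite-involutive t)

  ⟦⟧-injective : ∀ {x y} → ⟦ x ⟧ ≡ ⟦ y ⟧ → x ≡ y
  ⟦⟧-injective {x} {y} eq = trans (sym (fromFin-⟦⟧ x)) (trans (cong fromFin eq) (fromFin-⟦⟧ y))

  fromFin-injective : ∀ {i j} → fromFin i ≡ fromFin j → i ≡ j
  fromFin-injective {i} {j} eq = trans (sym (⟦⟧-fromFin i)) (trans (cong ⟦_⟧ eq) (⟦⟧-fromFin j))

  balanced↔ : Balanced m ↔ Fin (suc m + m)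
  balanced↔ = mk↔ₛ′ ⟦_⟧ fromFin ⟦⟧-fromFin fromFin-⟦⟧

  _≟_ : DecidableEquality (Balanced m)
  x ≟ y = map′ ⟦⟧-injective (cong ⟦_⟧) (⟦ x ⟧ Fin.≟ ⟦ y ⟧)

  ⟦+[1+s]⟧+⟦-[1+s]⟧≡q : ∀ s → toℕ ⟦ +[ Fin.suc s ] ⟧ + toℕ ⟦ -[1+ s ] ⟧ ≡ suc m + m
  ⟦+[1+s]⟧+⟦-[1+s]⟧≡q s = begin
    toℕ ⟦ +[ Fin.suc s ] ⟧ + toℕ ⟦ -[1+ s ] ⟧
      ≡⟨ cong₂ _+_ (toℕ-↑ˡ (Fin.suc s) m) (toℕ-↑ʳ (suc m) (opposite s)) ⟩
    suc (toℕ s) + (suc m + toℕ (opposite s))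
      ≡⟨ cong (λ r → suc (toℕ s) + (suc m + r)) (opposite-prop s) ⟩
    suc (toℕ s) + (suc m + (m ∸ suc (toℕ s)))
      ≡⟨ x∙yz≈y∙xz +-commutativeSemigroup (suc (toℕ s)) (suc m) _ ⟩
    suc m + (suc (toℕ s) + (m ∸ suc (toℕ s)))
      ≡⟨ cong (suc m +_) (m+[n∸m]≡n (toℕ<n s)) ⟩
    suc m + m
      ∎
    where open ≡-Reasoning

  q∣⟦x⟧+⟦-x⟧ : ∀ x → suc (m + m) ∣ toℕ ⟦ x ⟧ + toℕ ⟦ - x ⟧
  q∣⟦x⟧+⟦-x⟧ +[ 0F ]        = _ ∣0
  q∣⟦x⟧+⟦-x⟧ +[ Fin.suc s ] = ∣-reflexive (sym (⟦+[1+s]⟧+⟦-[1+s]⟧≡q s))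
  q∣⟦x⟧+⟦-x⟧ -[1+ s ]       =
    ∣-reflexive (sym (trans (+-comm (toℕ ⟦ -[1+ s ] ⟧) _) (⟦+[1+s]⟧+⟦-[1+s]⟧≡q s)))

  q∣⟦x⟧+⟦y⟧⇔y≡-x : ∀ x y → suc (m + m) ∣ toℕ ⟦ x ⟧ + toℕ ⟦ y ⟧ ⇔ y ≡ - x
  q∣⟦x⟧+⟦y⟧⇔y≡-x x y = mk⇔
    (λ q∣⟦x⟧+⟦y⟧ → ⟦⟧-injective (toℕ-injective
      (d∣m+n∧d∣m+o⇒n≡o q∣⟦x⟧+⟦y⟧ (q∣⟦x⟧+⟦-x⟧ x) (toℕ<n ⟦ y ⟧) (toℕ<n ⟦ - x ⟧))))
    (λ { refl → q∣⟦x⟧+⟦-x⟧ x })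

  balanced : ℕ → Balanced m
  balanced n = fromFin (n mod suc (m + m))

  toℕ-⟦balanced⟧ : ∀ n → toℕ ⟦ balanced n ⟧ ≡ n % suc (m + m)
  toℕ-⟦balanced⟧ n = trans (cong toℕ (⟦⟧-fromFin _)) (toℕ-fromℕ< _)

  q∣m+n⇔balanced : ∀ a b → suc (m + m) ∣ a + b ⇔ balanced b ≡ - balanced a
  q∣m+n⇔balanced a b =
    subst₂ (λ r s → suc (m + m) ∣ r + s ⇔ balanced b ≡ - balanced a)
           (toℕ-⟦balanced⟧ a) (toℕ-⟦balanced⟧ b) (q∣⟦x⟧+⟦y⟧⇔y≡-x (balanced a) (balanced b))
    ⇔-∘ ∣m+n⇔∣m%d+n%d a b (suc (m + m))

-- U(ℤ₃q) in coordinates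

module _ (m : ℕ) (q-prime : Prime (suc (m + m))) (3<q : 3 < suc (m + m)) where

  q N K : ℕ
  q = suc (m + m)
  N = 3 * q
  K = q + suc m

  G : Graph N
  G = unitaryAdditionCayley N

  ℤ₃ Coords : Set
  ℤ₃ = Balanced 1
  Coords = ℤ₃ × Balanced m

  pattern 0₃ = +[ 0F ]
  pattern 1₃ = +[ 1F ]
  pattern 2₃ = -[1+ 0F ]

  ρ₃ : Fin N → ℤ₃
  ρ₃ u = balanced (toℕ u)

  ρq : Fin N → Balanced m
  ρq u = balanced (toℕ u)

  coords : Fin N → Coords
  coords u = ρ₃ u , ρq u

  open ChineseRemainder (Coprimality.sym (prime⇒coprime q-prime 3<q))

  coords-injective : ∀ {u v} → ρ₃ u ≡ ρ₃ v → ρq u ≡ ρq v → u ≡ v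
  coords-injective eq₃ eqq = residues-injective (cong₂ _,_ (fromFin-injective eq₃) (fromFin-injective eqq))

  vertex : Coords → Fin N
  vertex (a , r) = proj₁ (residues-surjective (⟦ a ⟧ , ⟦ r ⟧))

  coords-vertex : ∀ x → coords (vertex x) ≡ x
  coords-vertex (a , r) = cong₂ _,_ (trans (cong (fromFin ∘ proj₁) eq) (fromFin-⟦⟧ a))
                                    (trans (cong (fromFin ∘ proj₂) eq) (fromFin-⟦⟧ r))
    where
    eq : residues (vertex (a , r)) ≡ (⟦ a ⟧ , ⟦ r ⟧)
    eq = proj₂ (residues-surjective (⟦ a ⟧ , ⟦ r ⟧))

  UnitSum : Coords → Coords → Set
  UnitSum x y = proj₁ y ≢ - proj₁ x × proj₂ y ≢ - proj₂ x

  unitSum-sym : ∀ {x y} → UnitSum x y → UnitSum y x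
  unitSum-sym (≢₃ , ≢q) = ≢₃ ∘ neg-sym , ≢q ∘ neg-sym

  unitSum⇔isUnit : ∀ u v → UnitSum (coords u) (coords v) ⇔ IsUnitℤ N (addℤ N u v)
  unitSum⇔isUnit u v = mk⇔
    (λ (≢₃ , ≢q) → from isUnit⇔ (≢₃ ∘ to 3∣⇔ , ≢q ∘ to q∣⇔))
    (λ unit → let (3∤ , q∤) = to isUnit⇔ unit in 3∤ ∘ from 3∣⇔ , q∤ ∘ from q∣⇔)
    where
    open Equivalence
    isUnit⇔ : IsUnitℤ N (addℤ N u v) ⇔ (¬ 3 ∣ toℕ u + toℕ v × ¬ q ∣ toℕ u + toℕ v)
    isUnit⇔ = isUnit[%]⇔¬∣ (from-yes (prime? 3)) q-prime (toℕ u + toℕ v)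
    3∣⇔ : 3 ∣ toℕ u + toℕ v ⇔ ρ₃ v ≡ - ρ₃ u
    3∣⇔ = q∣m+n⇔balanced (toℕ u) (toℕ v)
    q∣⇔ : q ∣ toℕ u + toℕ v ⇔ ρq v ≡ - ρq u
    q∣⇔ = q∣m+n⇔balanced (toℕ u) (toℕ v)

  nonzero-distinct⇒opposite : ∀ {a b : ℤ₃} → a ≢ 0₃ → b ≢ 0₃ → a ≢ b → b ≡ - a
  nonzero-distinct⇒opposite {0₃}      a≢0 _   _   = contradiction refl a≢0
  nonzero-distinct⇒opposite {_} {0₃}  _   b≢0 _   = contradiction refl b≢0
  nonzero-distinct⇒opposite {1₃} {1₃} _   _   a≢b = contradiction refl a≢b
  nonzero-distinct⇒opposite {1₃} {2₃} _   _   _   = refl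
  nonzero-distinct⇒opposite {2₃} {1₃} _   _   _   = refl
  nonzero-distinct⇒opposite {2₃} {2₃} _   _   a≢b = contradiction refl a≢b

  module UpperBound {k} (χ : CompleteColoring G k) where
    open CompleteColoring χ renaming (color to c)

    rep : Fin k → Fin N
    rep i = proj₁ (surj i)

    c-rep : ∀ i → c (rep i) ≡ i
    c-rep i = proj₂ (surj i)

    sameColour⇒¬unitSum : ∀ {u v} → c u ≡ c v → u ≢ v → ¬ UnitSum (coords u) (coords v)
    sameColour⇒¬unitSum {u} {v} cu≡cv u≢v u+v-unit =
      proper u v (u≢v , Equivalence.to (unitSum⇔isUnit u v) u+v-unit) cu≡cv

    distinctColours-joined : ∀ {i j} → i ≢ j →
                             ∃₂ λ u v → u ≢ v × UnitSum (coords u) (coords v) × c u ≡ i × c v ≡ j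
    distinctColours-joined {i} {j} i≢j =
      let (u , v , (u≢v , unit) , cu≡i , cv≡j) = complete i j i≢j
      in u , v , u≢v , Equivalence.from (unitSum⇔isUnit u v) unit , cu≡i , cv≡j

    sameColour⇒ρq≡-ρq : ∀ {u v} → c u ≡ c v → ρ₃ v ≡ 0₃ → ρ₃ u ≢ 0₃ → ρq u ≡ - ρq v
    sameColour⇒ρq≡-ρq {u} {v} cu≡cv v∈V₀ u∉V₀ = decidable-stable (ρq u ≟ - ρq v) λ ≢q →
      sameColour⇒¬unitSum (sym cu≡cv) (λ v≡u → u∉V₀ (trans (cong ρ₃ (sym v≡u)) v∈V₀))
        ((λ ρ₃u≡-ρ₃v → u∉V₀ (trans ρ₃u≡-ρ₃v (cong -_ v∈V₀))) , ≢q)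

    InsideV₀ : Fin k → Set
    InsideV₀ i = ∀ u → c u ≡ i → ρ₃ u ≡ 0₃

    insideV₀? : ∀ i → Dec (InsideV₀ i)
    insideV₀? i = all? (λ u → (c u Fin.≟ i) →-dec (ρ₃ u ≟ 0₃))

    insideV₀-unique : ∀ {i j} → InsideV₀ i → InsideV₀ j → i ≡ j
    insideV₀-unique {i} {j} i⊆V₀ j⊆V₀ = decidable-stable (i Fin.≟ j) λ i≢j →
      let (u , v , _ , (≢₃ , _) , cu≡i , cv≡j) = distinctColours-joined i≢j
      in ≢₃ (trans (j⊆V₀ v cv≡j) (cong -_ (sym (i⊆V₀ u cu≡i))))

    Singleton : Fin N → Set
    Singleton w = ∀ u → c u ≡ c w → u ≡ w

    singleton? : ∀ w → Dec (Singleton w)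
    singleton? w = all? (λ u → (c u Fin.≟ c w) →-dec (u Fin.≟ w))

    joined-to-singleton : ∀ {i w} → Singleton w → i ≢ c w →
                          ∃ λ a → c a ≡ i × a ≢ w × UnitSum (coords a) (coords w)
    joined-to-singleton {i} {w} sw i≢cw =
      let (a , b , a≢b , a+b-unit , ca≡i , cb≡cw) = distinctColours-joined {i} {c w} i≢cw
          b≡w = sw b cb≡cw
      in a , ca≡i , subst (a ≢_) b≡w a≢b , subst (λ x → UnitSum (coords a) (coords x)) b≡w a+b-unit

    singletons-unitSum : ∀ {w w′} → Singleton w → Singleton w′ → w ≢ w′ → UnitSum (coords w) (coords w′)
    singletons-unitSum {w} {w′} sw sw′ w≢w′ =
      let (a , ca≡cw , _ , a+w′-unit) = joined-to-singleton {c w} sw′ (λ cw≡cw′ → w≢w′ (sw′ w cw≡cw′))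
      in subst (λ x → UnitSum (coords x) (coords w′)) (sw a ca≡cw) a+w′-unit

    Partner : Fin N → Fin N → Set
    Partner v w = ρ₃ v ≡ 0₃ × ρ₃ w ≢ 0₃ × ρq w ≡ - ρq v × Singleton w

    partner? : ∀ v w → Dec (Partner v w)
    partner? v w = (ρ₃ v ≟ 0₃) ×-dec ¬? (ρ₃ w ≟ 0₃) ×-dec (ρq w ≟ - ρq v) ×-dec singleton? w

    partner-unique : ∀ {v w w′} → Partner v w → Partner v w′ → w ≡ w′
    partner-unique {w = w} {w′} (_ , w∉V₀ , w≡-v , sw) (_ , w′∉V₀ , w′≡-v , sw′) =
      decidable-stable (w Fin.≟ w′) λ w≢w′ → w≢w′ (coords-injective
        (decidable-stable (ρ₃ w ≟ ρ₃ w′) λ ≢₃ →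
          proj₁ (singletons-unitSum sw sw′ w≢w′) (nonzero-distinct⇒opposite w∉V₀ w′∉V₀ ≢₃))
        (trans w≡-v (sym w′≡-v)))

    -- a ∈ V₀, for otherwise a would have the coordinates of w.  A vertex u ∉ V₀ of the class
    -- would then be q-opposite to both a and v, forcing a = v, which is not joined to w.
    partner-joined-class-insideV₀ : ∀ {v w a} → Partner v w → c a ≡ c v → a ≢ w →
                                    UnitSum (coords a) (coords w) → InsideV₀ (c v)
    partner-joined-class-insideV₀ {v} {w} {a} (v∈V₀ , w∉V₀ , w≡-v , _) ca≡cv a≢w a+w-unit u cu≡cv =
      decidable-stable (ρ₃ u ≟ 0₃) λ u∉V₀ → a≢v (coords-injective (trans a∈V₀ (sym v∈V₀)) (ρqa≡ρqv u∉V₀))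
      where
      a≢v : a ≢ v
      a≢v refl = proj₂ a+w-unit w≡-v
      a∈V₀ : ρ₃ a ≡ 0₃
      a∈V₀ = decidable-stable (ρ₃ a ≟ 0₃) λ a∉V₀ →
        let ρ₃a≡ρ₃w = decidable-stable (ρ₃ a ≟ ρ₃ w) λ ≢₃ →
                        proj₁ a+w-unit (nonzero-distinct⇒opposite a∉V₀ w∉V₀ ≢₃)
            ρqa≡ρqw = trans (sameColour⇒ρq≡-ρq ca≡cv v∈V₀ a∉V₀) (sym w≡-v)
        in a≢w (coords-injective ρ₃a≡ρ₃w ρqa≡ρqw)
      ρqa≡ρqv : ρ₃ u ≢ 0₃ → ρq a ≡ ρq v
      ρqa≡ρqv u∉V₀ = neg-injective (trans (sym (sameColour⇒ρq≡-ρq (trans cu≡cv (sym ca≡cv)) a∈V₀ u∉V₀))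
                                          (sameColour⇒ρq≡-ρq cu≡cv v∈V₀ u∉V₀))

    partner-class-insideV₀ : ∀ {v w} → Partner v w → InsideV₀ (c v)
    partner-class-insideV₀ {v} {w} v∼w@(v∈V₀ , w∉V₀ , _ , sw) =
      let (a , ca≡cv , a≢w , a+w-unit) = joined-to-singleton {c v} sw cv≢cw
      in partner-joined-class-insideV₀ {v} {w} {a} v∼w ca≡cv a≢w a+w-unit
      where
      cv≢cw : c v ≢ c w
      cv≢cw cv≡cw = w∉V₀ (trans (cong ρ₃ (sym (sw v cv≡cw))) v∈V₀)

    -- Colour i owns the tokens (i , 0F) and (i , 1F).  A vertex pays a token of its own class
    -- (rep i pays (i , 0F)) unless it is the partner v of a singleton class {w}, in which case it
    -- pays (c w , 1F); the two extra sources pay for the class inside V₀.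
    slot : Fin N → Fin 2
    slot v with v Fin.≟ rep (c v)
    ... | yes _ = 0F
    ... | no  _ = 1F

    c₀ : Fin k
    c₀ with any? insideV₀?
    ... | yes (i , _) = i
    ... | no  _       = c Fin.zero    -- arbitrary: no class lies inside V₀

    token : Fin N ⊎ Fin 2 → Fin k × Fin 2
    token (inj₁ v) with any? (partner? v)
    ... | yes (w , _) = c w , 1F
    ... | no  _       = c v , slot v
    token (inj₂ b) = c₀ , b

    c₀-insideV₀ : ∀ {i} → InsideV₀ i → c₀ ≡ i
    c₀-insideV₀ i⊆V₀ with any? insideV₀?
    ... | yes (j , j⊆V₀) = insideV₀-unique j⊆V₀ i⊆V₀
    ... | no  none       = contradiction (_ , i⊆V₀) none

    token-partner : ∀ {v w} → Partner v w → token (inj₁ v) ≡ (c w , 1F)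
    token-partner {v} v∼w with any? (partner? v)
    ... | yes (w′ , v∼w′) = cong (λ x → c x , 1F) (partner-unique {v} v∼w′ v∼w)
    ... | no  none        = contradiction (_ , v∼w) none

    token-own : ∀ {v} → ¬ InsideV₀ (c v) → token (inj₁ v) ≡ (c v , slot v)
    token-own {v} cv⊈V₀ with any? (partner? v)
    ... | yes (_ , v∼w) = contradiction (partner-class-insideV₀ v∼w) cv⊈V₀
    ... | no  _         = refl

    slot-rep : ∀ i → slot (rep i) ≡ 0F
    slot-rep i with rep i Fin.≟ rep (c (rep i))
    ... | yes _       = refl
    ... | no  rep≢rep = contradiction (cong rep (sym (c-rep i))) rep≢rep

    slot-other : ∀ {v} → v ≢ rep (c v) → slot v ≡ 1F
    slot-other {v} v≢rep with v Fin.≟ rep (c v)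
    ... | yes v≡rep = contradiction v≡rep v≢rep
    ... | no  _     = refl

    singleton-token-hit : ∀ {i} → ¬ InsideV₀ i → Singleton (rep i) → ∃ λ s → token s ≡ (i , 1F)
    singleton-token-hit {i} i⊈V₀ sw = inj₁ v , trans (token-partner {v} v∼w) (cong (_, 1F) (c-rep i))
      where
      w v : Fin N
      w = rep i
      v = vertex (0₃ , - ρq w)
      w∉V₀ : ρ₃ w ≢ 0₃
      w∉V₀ w∈V₀ = i⊈V₀ λ u cu≡i → trans (cong ρ₃ (sw u (trans cu≡i (sym (c-rep i))))) w∈V₀
      v∼w : Partner v w
      v∼w = cong proj₁ (coords-vertex (0₃ , - ρq w)) , w∉V₀ ,
            sym (trans (cong -_ (cong proj₂ (coords-vertex (0₃ , - ρq w)))) (neg-involutive (ρq w))) , sw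

    token-hit : ∀ {i} → ¬ InsideV₀ i → ∀ b → ∃ λ s → token s ≡ (i , b)
    token-hit {i} i⊈V₀ 0F = inj₁ (rep i) ,
      trans (token-own (subst (¬_ ∘ InsideV₀) (sym (c-rep i)) i⊈V₀)) (cong₂ _,_ (c-rep i) (slot-rep i))
    token-hit {i} i⊈V₀ 1F with any? (λ u → (c u Fin.≟ i) ×-dec ¬? (u Fin.≟ rep i))
    ... | yes (u , cu≡i , u≢rep) = inj₁ u ,
      trans (token-own (subst (¬_ ∘ InsideV₀) (sym cu≡i) i⊈V₀))
            (cong₂ _,_ cu≡i (slot-other (subst (λ j → u ≢ rep j) (sym cu≡i) u≢rep)))
    ... | no  none = singleton-token-hit i⊈V₀ λ u cu≡ci →
      decidable-stable (u Fin.≟ rep i) λ u≢rep → none (u , trans cu≡ci (c-rep i) , u≢rep)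

    token-surjective : ∀ t → ∃ λ s → token s ≡ t
    token-surjective (i , b) with insideV₀? i
    ... | yes i⊆V₀ = inj₂ b , cong (_, b) (c₀-insideV₀ i⊆V₀)
    ... | no  i⊈V₀ = token-hit i⊈V₀ b

    k*2≤N+2 : k * 2 ≤ N + 2
    k*2≤N+2 = surjection⇒≤ +↔⊎ *↔× token token-surjective

  upperBound : ∀ {k} → CompleteColoring G k → k ≤ K
  upperBound {k} χ = s≤s⁻¹ (*-cancelʳ-< 2 k (suc K) k*2<[1+K]*2)
    where
    [3q+2]+1≡[1+K]*2 : ∀ m → suc (3 * suc (m + m) + 2) ≡ suc (suc (m + m) + suc m) * 2
    [3q+2]+1≡[1+K]*2 = solve-∀
    k*2<[1+K]*2 : k * 2 < suc K * 2
    k*2<[1+K]*2 = subst (k * 2 <_) ([3q+2]+1≡[1+K]*2 m) (s≤s (UpperBound.k*2≤N+2 χ))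

  -- The lower-bound colouring

  Colour : Set
  Colour = Balanced m ⊎ Fin (suc m)

  colour : Coords → Colour
  colour (0₃ , r)                = inj₁ r
  colour (1₃ , +[ s ])           = inj₂ s
  colour (1₃ , -[1+ s ])         = inj₁ +[ Fin.suc s ]
  colour (2₃ , +[ 0F ])          = inj₂ (opposite 0F)
  colour (2₃ , +[ Fin.suc s ])   = inj₁ -[1+ s ]
  colour (2₃ , -[1+ s ])         = inj₂ (opposite (Fin.suc s))

  side : Balanced m → ℤ₃
  side +[ 0F ]        = 0₃
  side +[ Fin.suc _ ] = 1₃
  side -[1+ _ ]       = 2₃

  -- The class of colour inj₂ s pairs (1, s) with (2, −(m − s)); using opposite rather than
  -- the identity keeps (1, 0) and (2, 0) apart, so that (0, 0) is joined to every such class.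
  first second : Colour → Coords
  first  (inj₁ r) = 0₃ , r
  first  (inj₂ s) = 1₃ , +[ s ]
  second (inj₁ r) = side r , - r
  second (inj₂ s) = 2₃ , - +[ opposite s ]

  colour-first : ∀ γ → colour (first γ) ≡ γ
  colour-first (inj₁ r) = refl
  colour-first (inj₂ s) = refl

  colour-second : ∀ γ → colour (second γ) ≡ γ
  colour-second (inj₁ +[ 0F ])        = refl
  colour-second (inj₁ +[ Fin.suc s ]) = refl
  colour-second (inj₁ -[1+ s ])       = refl
  colour-second (inj₂ s)              = trans (colour-2₃ (opposite s)) (cong inj₂ (opposite-involutive s))
    where
    colour-2₃ : ∀ t → colour (2₃ , - +[ t ]) ≡ inj₂ (opposite t)
    colour-2₃ 0F          = refl
    colour-2₃ (Fin.suc t) = refl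

  second-inj₂-opposite : ∀ t → second (inj₂ (opposite t)) ≡ (2₃ , - +[ t ])
  second-inj₂-opposite t = cong (λ t′ → 2₃ , - +[ t′ ]) (opposite-involutive t)

  first-or-second : ∀ x → x ≡ first (colour x) ⊎ x ≡ second (colour x)
  first-or-second (0₃ , r)              = inj₁ refl
  first-or-second (1₃ , +[ s ])         = inj₁ refl
  first-or-second (1₃ , -[1+ s ])       = inj₂ refl
  first-or-second (2₃ , +[ 0F ])        = inj₂ (sym (second-inj₂-opposite 0F))
  first-or-second (2₃ , +[ Fin.suc s ]) = inj₂ refl
  first-or-second (2₃ , -[1+ s ])       = inj₂ (sym (second-inj₂-opposite (Fin.suc s)))

  ¬unitSum-first-second : ∀ γ → ¬ UnitSum (first γ) (second γ)
  ¬unitSum-first-second (inj₁ r) (_ , ≢q) = ≢q refl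
  ¬unitSum-first-second (inj₂ s) (≢₃ , _) = ≢₃ refl

  sameColour-unitSum⇒≡ : ∀ {x y} → colour x ≡ colour y → UnitSum x y → x ≡ y
  sameColour-unitSum⇒≡ {x} {y} cx≡cy x+y-unit with first-or-second x | first-or-second y
  ... | inj₁ x≡f | inj₁ y≡f = trans x≡f (trans (cong first cx≡cy) (sym y≡f))
  ... | inj₂ x≡s | inj₂ y≡s = trans x≡s (trans (cong second cx≡cy) (sym y≡s))
  ... | inj₁ x≡f | inj₂ y≡s = contradiction
    (subst₂ UnitSum x≡f (trans y≡s (cong second (sym cx≡cy))) x+y-unit)
    (¬unitSum-first-second (colour x))
  ... | inj₂ x≡s | inj₁ y≡f = contradiction
    (subst₂ UnitSum y≡f (trans x≡s (cong second cx≡cy)) (unitSum-sym x+y-unit))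
    (¬unitSum-first-second (colour y))

  Joined : Colour → Colour → Set
  Joined γ δ = ∃₂ λ x y → colour x ≡ γ × colour y ≡ δ × UnitSum x y

  joined-sym : ∀ {γ δ} → Joined γ δ → Joined δ γ
  joined-sym (x , y , cx≡γ , cy≡δ , x+y-unit) = y , x , cy≡δ , cx≡γ , unitSum-sym x+y-unit

  m≢0 : m ≢ 0
  m≢0 refl = contradiction 3<q λ { (s≤s ()) }

  +[s]≢-+[opposite-s] : ∀ s → +[ s ] ≢ - +[ opposite s ]
  +[s]≢-+[opposite-s] s eq = m≢0 (begin
    m                         ≡⟨ opposite-prop {suc m} 0F ⟨
    toℕ (opposite {suc m} 0F) ≡⟨ cong (toℕ ∘ opposite) s≡0 ⟨
    toℕ (opposite s)          ≡⟨ cong toℕ opposite-s≡0 ⟩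
    0                         ∎)
    where
    open ≡-Reasoning
    s≡0 : s ≡ 0F
    s≡0 = proj₁ (+[s]≡-+[t]⇒s≡t≡0 eq)
    opposite-s≡0 : opposite s ≡ 0F
    opposite-s≡0 = proj₂ (+[s]≡-+[t]⇒s≡t≡0 eq)

  first-second-joined : ∀ {r t} → r ≢ t → t ≢ +[ 0F ] → Joined (inj₁ r) (inj₁ t)
  first-second-joined {r} {t} r≢t t≢0 =
    first (inj₁ r) , second (inj₁ t) , refl , colour-second (inj₁ t) ,
    side≢0 t t≢0 , r≢t ∘ sym ∘ neg-injective
    where
    side≢0 : ∀ t → t ≢ +[ 0F ] → side t ≢ 0₃
    side≢0 +[ 0F ]        t≢0 = contradiction refl t≢0
    side≢0 +[ Fin.suc _ ] _   = λ ()
    side≢0 -[1+ _ ]       _   = λ ()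

  colours-joined : ∀ γ δ → γ ≢ δ → Joined γ δ
  colours-joined (inj₁ r) (inj₁ t) γ≢δ with t ≟ +[ 0F ]
  ... | no  t≢0  = first-second-joined (γ≢δ ∘ cong inj₁) t≢0
  ... | yes refl = joined-sym (first-second-joined (γ≢δ ∘ cong inj₁ ∘ sym) (γ≢δ ∘ cong inj₁))
  colours-joined (inj₁ r) (inj₂ s) _ with +[ s ] ≟ - r
  ... | no  ≢q = first (inj₁ r) , first (inj₂ s) , refl , refl , (λ ()) , ≢q
  ... | yes ≡q = first (inj₁ r) , second (inj₂ s) , refl , colour-second (inj₂ s) , (λ ()) ,
    λ ≡q′ → +[s]≢-+[opposite-s] s (trans ≡q (cong -_ (neg-injective (sym ≡q′))))
  colours-joined (inj₂ s) (inj₁ r) γ≢δ = joined-sym (colours-joined (inj₁ r) (inj₂ s) (γ≢δ ∘ sym))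
  colours-joined (inj₂ s) (inj₂ t) γ≢δ =
    first (inj₂ s) , first (inj₂ t) , refl , refl , (λ ()) ,
    λ t≡-s → let (t≡0 , s≡0) = +[s]≡-+[t]⇒s≡t≡0 t≡-s in γ≢δ (cong inj₂ (trans s≡0 (sym t≡0)))

  colour↔ : Colour ↔ Fin K
  colour↔ = ↔-sym +↔⊎ ↔-∘ (balanced↔ ⊎-↔ ↔-refl)

  vertices-adjacent : ∀ {x y} → colour x ≢ colour y → UnitSum x y → Adj G (vertex x) (vertex y)
  vertices-adjacent {x} {y} cx≢cy x+y-unit =
    (λ u≡v → cx≢cy (subst₂ (λ x′ y′ → colour x′ ≡ colour y′) (coords-vertex x) (coords-vertex y)
                            (cong (colour ∘ coords) u≡v))) ,
    Equivalence.to (unitSum⇔isUnit (vertex x) (vertex y))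
      (subst₂ UnitSum (sym (coords-vertex x)) (sym (coords-vertex y)) x+y-unit)

  lowerBound : CompleteColoring G K
  lowerBound = completeColoring-via colour↔ (colour ∘ coords) proper′ surj′ complete′
    where
    proper′ : ∀ u v → Adj G u v → colour (coords u) ≢ colour (coords v)
    proper′ u v (u≢v , unit) cu≡cv = u≢v (coords-injective (cong proj₁ coords≡) (cong proj₂ coords≡))
      where
      coords≡ : coords u ≡ coords v
      coords≡ = sameColour-unitSum⇒≡ {coords u} {coords v} cu≡cv (Equivalence.from (unitSum⇔isUnit u v) unit)
    colour-vertex : ∀ x → colour (coords (vertex x)) ≡ colour x
    colour-vertex x = cong colour (coords-vertex x)
    surj′ : ∀ γ → ∃ λ u → colour (coords u) ≡ γ
    surj′ γ = vertex (first γ) , trans (colour-vertex (first γ)) (colour-first γ)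
    complete′ : ∀ γ δ → γ ≢ δ → ∃₂ λ u v → Adj G u v × colour (coords u) ≡ γ × colour (coords v) ≡ δ
    complete′ γ δ γ≢δ =
      let (x , y , cx≡γ , cy≡δ , x+y-unit) = colours-joined γ δ γ≢δ
      in vertex x , vertex y ,
         vertices-adjacent {x} {y} (λ cx≡cy → γ≢δ (trans (sym cx≡γ) (trans cx≡cy cy≡δ))) x+y-unit ,
         trans (colour-vertex x) cx≡γ , trans (colour-vertex y) cy≡δ

  achromaticNumber : AchromaticNumber G K
  achromaticNumber = lowerBound , λ _ → upperBound

odd⇒≡1+2m : ∀ n → ¬ 2 ∣ n → ∃ λ m → n ≡ suc (m + m)
odd⇒≡1+2m zero          2∤n = contradiction (2 ∣0) 2∤n
odd⇒≡1+2m (suc zero)    _   = 0 , refl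
odd⇒≡1+2m (suc (suc n)) 2∤n with odd⇒≡1+2m n (2∤n ∘ ∣m∣n⇒∣m+n ∣-refl)
... | m , refl = suc m , cong suc (sym (+-suc (suc m) m))

theorem3 : (q : ℕ) → (pq : Prime q) → 3 < q →
           AchromaticNumber
             (unitaryAdditionCayley (3 * q) {{m*n≢0 3 q {{_}} {{prime⇒nonZero pq}}}})
             ((3 * q + 1) / 2)
theorem3 q q-prime 3<q with odd⇒≡1+2m q 2∤q
  where
  2∤q : ¬ 2 ∣ q
  2∤q 2∣q with prime⇒irreducible q-prime 2∣q
  ... | inj₁ ()
  ... | inj₂ 2≡q = <⇒≢ (<⇒≤ 3<q) 2≡q
... | m , refl = subst (AchromaticNumber (G m q-prime 3<q)) (sym [3q+1]/2≡K) (achromaticNumber m q-prime 3<q)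
  where
  3q+1≡K*2 : ∀ m → 3 * suc (m + m) + 1 ≡ (suc (m + m) + suc m) * 2
  3q+1≡K*2 = solve-∀
  [3q+1]/2≡K : (3 * suc (m + m) + 1) / 2 ≡ suc (m + m) + suc m
  [3q+1]/2≡K = trans (cong (_/ 2) (3q+1≡K*2 m)) (m*n/n≡m (suc (m + m) + suc m) 2)
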